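{- Let $n\ge2$, $1\le k\le n$, $1\le i<n$ and $w\in S_n$ (with $\mathrm{SVT}^n_w(\Lambda_k)$ defined via any reduced expression of $w$). Let $b\in\mathrm{SVT}^n(\Lambda_k)$ satisfy $e_ib=0$ and $e_i^Kb=0$, and let $S$ be its $i$-K-string. Then $\mathrm{SVT}^n_w(\Lambda_k)\cap S$ is either $\emptyset$, $S$, or $\{b\}$.
   Context: $\mathrm{SVT}^n(\Lambda_k)$ is the set of single-column semistandard set-valued tableaux of height $k$ with entries at most $n$: sequences of nonempty sets $A_1,\dots,A_k\subseteq\{1,\dots,n\}$ (top to bottom) with $\max A_r<\min A_{r+1}$. For $1\le i<n$: $f_iT=0$ unless $i\in T$ and $i+1\notin T$, in which case $f_iT$ replaces $i$ by $i+1$; $e_iT=0$ unless $i+1\in T$ and $i\notin T$, in which case $e_iT$ replaces $i+1$ by $i$. K-crystal operators: $f_i^KT=0$ if $i\notin T$ or $i+1\in T$; otherwise $f_i^KT$ adds $i+1$ to the box containing $i$. $e_i^KT=0$ if no box contains both $i$ and $i+1$; otherwise $e_i^KT$ deletes $i+1$ from that box. For $g\in\{e_i,e_i^K\}$, $g^{\max}T=g^rT$ with $r$ maximal with $g^rT\ne0$. Let $u$ be the column $\{1\},\dots,\{k\}$. For a reduced expression $w=s_{i_1}\cdots s_{i_\ell}$, $\mathrm{SVT}^n_w(\Lambda_k)=\{T : (e^K_{i_\ell})^{\max}e_{i_\ell}^{\max}\cdots(e^K_{i_1})^{\max}e_{i_1}^{\max}T=u\}$ (rightmost operator applied first). The $i$-K-string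 of $b$ (with $e_ib=e_i^Kb=0$) is the set of nonzero elements among $f_i^ab$ and $f_i^af_i^Kb$, $a\ge0$. -}

module Defs where

open import Data.Nat using (ℕ; zero; suc; _+_; _<_; _≤_; _≡ᵇ_; _<ᵇ_)
open import Data.Bool using (Bool; true; false; if_then_else_; _∧_; not)
open import Data.List using (List; []; _∷_; map; concat; concatMap; length; upTo)
open import Data.Bool.ListAction using (any)
open import Data.Nat.ListAction using (sum)
open import Data.List.Relation.Unary.All using (All)
open import Data.Maybe using (Maybe; just; nothing; _>>=_)
open import Data.Product using (_×_; ∃)
open import Data.Sum using (_⊎_)
open import Data.Unit using (⊤)
open import Relation.Binary.PropositionalEquality using (_≡_)

-- A box of a column: a finite set of positive integers, represented as a
-- strictly increasing list.  A single column is a list of boxes (top to bottom).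
Box : Set
Box = List ℕ

Column : Set
Column = List Box

Sorted : List ℕ → Set
Sorted [] = ⊤
Sorted (x ∷ []) = ⊤
Sorted (x ∷ y ∷ xs) = x < y × Sorted (y ∷ xs)

NonEmpty : Box → Set
NonEmpty [] = Data.Empty.⊥ where import Data.Empty
NonEmpty (_ ∷ _) = ⊤

-- T ∈ SVT^n(Λ_k): k nonempty boxes, entries in {1..n}, max A_r < min A_{r+1}
-- (equivalently: the concatenation of the boxes is strictly increasing).
Valid : ℕ → ℕ → Column → Set
Valid n k T =
  length T ≡ k × All NonEmpty T × Sorted (concat T) ×
  All (λ x → 1 ≤ x × x ≤ n) (concat T)

mem : ℕ → Column → Bool
mem i T = any (λ x → x ≡ᵇ i) (concat T)

memBox : ℕ → Box → Bool
memBox i B = any (λ x → x ≡ᵇ i) B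

sameBox : ℕ → ℕ → Column → Bool
sameBox i j T = any (λ B → memBox i B ∧ memBox j B) T

removeVal : ℕ → Box → Box
removeVal j [] = []
removeVal j (x ∷ xs) = if x ≡ᵇ j then removeVal j xs else x ∷ removeVal j xs

-- crystal operators (nothing = 0)
f : ℕ → Column → Maybe Column
f i T = if mem i T ∧ not (mem (suc i) T)
        then just (map (map (λ x → if x ≡ᵇ i then suc i else x)) T)
        else nothing

e : ℕ → Column → Maybe Column
e i T = if mem (suc i) T ∧ not (mem i T)
        then just (map (map (λ x → if x ≡ᵇ suc i then i else x)) T)
        else nothing

fK : ℕ → Column → Maybe Column
fK i T = if mem i T ∧ not (mem (suc i) T)
         then just (map (concatMap (λ x → if x ≡ᵇ i then i ∷ suc i ∷ [] else x ∷ [])) T)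
         else nothing

eK : ℕ → Column → Maybe Column
eK i T = if sameBox i (suc i) T
         then just (map (removeVal (suc i)) T)
         else nothing

gmaxFuel : ℕ → (Column → Maybe Column) → Column → Column
gmaxFuel zero g T = T
gmaxFuel (suc m) g T with g T
... | nothing = T
... | just T' = gmaxFuel m g T'

-- every application of e_i decreases the sum of entries and every application
-- of e_i^K decreases the number of entries, so this fuel suffices to reach
-- the maximal r with g^r T ≠ 0.
measure : Column → ℕ
measure T = sum (concat T) + length (concat T)

gmax : (Column → Maybe Column) → Column → Column
gmax g T = gmaxFuel (measure T) g T

reduceWord : List ℕ → Column → Column
reduceWord [] T = T
reduceWord (j ∷ js) T = reduceWord js (gmax (eK j) (gmax (e j) T))

u : ℕ → Column
u k = map (λ j → suc j ∷ []) (upTo k)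

SVTw : ℕ → ℕ → List ℕ → Column → Set
SVTw n k word T = Valid n k T × reduceWord word T ≡ u k

swap : ℕ → ℕ → ℕ
swap i x = if x ≡ᵇ i then suc i else (if x ≡ᵇ suc i then i else x)

perm : List ℕ → ℕ → ℕ
perm [] x = x
perm (j ∷ js) x = swap j (perm js x)

count : List Bool → ℕ
count [] = 0
count (true ∷ bs) = suc (count bs)
count (false ∷ bs) = count bs

inversions : ℕ → (ℕ → ℕ) → ℕ
inversions n w =
  count (concatMap (λ a → map (λ b → (a <ᵇ b) ∧ (w b <ᵇ w a)) (map suc (upTo n)))
                   (map suc (upTo n)))

Reduced : ℕ → List ℕ → Set
Reduced n word =
  All (λ j → 1 ≤ j × j < n) word × inversions n (perm word) ≡ length word

fpow : ℕ → ℕ → Column → Maybe Column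
fpow i zero T = just T
fpow i (suc a) T = fpow i a T >>= f i

InString : ℕ → Column → Column → Set
InString i b T =
  ∃ λ a → fpow i a b ≡ just T ⊎ (∃ λ b' → fK i b ≡ just b' × fpow i a b' ≡ just T)

module Submission where

-- Whether reduceWord w T ≡ u k depends only on the list of box maxima
-- of T.  For a letter j ≥ 1 the composite (e^K_j)^max ∘ (e_j)^max acts on the
-- maxima by  lowerMax j : "if j+1 is a maximum and j is not, replace j+1 by j"
-- (three cases: e_j applies; j and j+1 share a box; neither).  Since u k is
-- the only well-formed column with maxima 1,…,k, a column lies in SVT_w iff
-- lowering its maxima along w yields 1,…,k.  The i-K-string is {b} when f_i b
-- is zero and {b, f_i b, f_i^K b} otherwise.  Now f_i b and f_i^K b have the
-- same maxima, so they lie in SVT_w together; and lowering along w is monotone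
-- for the pointwise order, with the maxima of b below those of f_i b, so
-- f_i b ∈ SVT_w forces b ∈ SVT_w.  A three-point counting lemma concludes.

open import Defs
open import Data.Bool using (Bool; true; false; if_then_else_; _∧_; not; T)
open import Data.Bool.Properties using (∧-zeroʳ; ∧-conicalˡ; ∧-conicalʳ; ∨-conicalʳ)
open import Data.Empty using (⊥-elim)
open import Data.List using (List; []; _∷_; map; concat; concatMap; length; upTo; _++_; applyUpTo)
open import Data.List.Membership.Propositional using (_∈_; _∉_)
open import Data.List.Membership.Propositional.Properties using (∈-++⁺ˡ; ∈-++⁺ʳ; ∈-++⁻; ∈-map⁻)
open import Data.List.Properties using (∷-injective; map-∘; map-applyUpTo; length-map; concat-map; concatMap-++; ≡-dec)
open import Data.List.Relation.Binary.Pointwise using (Pointwise; []; _∷_)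
open import Data.List.Relation.Unary.All as All using (All; []; _∷_)
open import Data.List.Relation.Unary.All.Properties using (map⁺; concat⁺)
open import Data.List.Relation.Unary.Any using (here; there)
open import Data.Maybe using (just; nothing)
open import Data.Maybe.Properties using (just-injective)
open import Data.Nat using (ℕ; zero; suc; _+_; _≤_; _<_; _≡ᵇ_; z≤n)
open import Data.Nat.Properties
open import Data.List.Membership.DecPropositional _≟_ using (_∈?_)
open import Data.Nat.ListAction using (sum)
open import Data.Product using (_×_; _,_; proj₁; proj₂; Σ)
open import Data.Sum using (_⊎_; inj₁; inj₂; [_,_]′)
open import Data.Unit using (⊤; tt)
open import Function using (_∘_; id)
open import Relation.Nullary using (¬_; yes; no; Dec)
open import Relation.Nullary.Decidable using (map′)
open import Relation.Binary.PropositionalEquality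

open ≡-Reasoning

if-true : ∀ {A : Set} {b} {x y : A} → b ≡ true → (if b then x else y) ≡ x
if-true refl = refl

if-false : ∀ {A : Set} {b} {x y : A} → b ≡ false → (if b then x else y) ≡ y
if-false refl = refl

not-true : ∀ {a} → not a ≡ true → a ≡ false
not-true {false} _ = refl

not-false : ∀ {a} → not a ≡ false → a ≡ true
not-false {true} _ = refl

∧-falseˡ : ∀ {a} b → a ≡ false → a ∧ b ≡ false
∧-falseˡ _ refl = refl

∧-falseʳ : ∀ a {b} → b ≡ false → a ∧ b ≡ false
∧-falseʳ a refl = ∧-zeroʳ a

≡ᵇ-sound : ∀ x y → (x ≡ᵇ y) ≡ true → x ≡ y
≡ᵇ-sound x y p = ≡ᵇ⇒≡ x y (subst T (sym p) tt)

≡ᵇ-refl : ∀ x → (x ≡ᵇ x) ≡ true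
≡ᵇ-refl zero = refl
≡ᵇ-refl (suc x) = ≡ᵇ-refl x

≡ᵇ-false : ∀ x y → x ≢ y → (x ≡ᵇ y) ≡ false
≡ᵇ-false x y x≢y with x ≡ᵇ y in eq
... | true = ⊥-elim (x≢y (≡ᵇ-sound x y eq))
... | false = refl

memBox-sound : ∀ y l → memBox y l ≡ true → y ∈ l
memBox-sound y (x ∷ l) p with x ≡ᵇ y in eq
... | true = here (sym (≡ᵇ-sound x y eq))
... | false = there (memBox-sound y l p)

memBox-complete : ∀ {y l} → y ∈ l → memBox y l ≡ true
memBox-complete {y} (here refl) rewrite ≡ᵇ-refl y = refl
memBox-complete {y} {x ∷ l} (there p) with x ≡ᵇ y
... | true = refl
... | false = memBox-complete p

memBox-false⇒∉ : ∀ {y l} → memBox y l ≡ false → y ∉ l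
memBox-false⇒∉ p q with trans (sym (memBox-complete q)) p
... | ()

∉⇒memBox-false : ∀ {y} l → y ∉ l → memBox y l ≡ false
∉⇒memBox-false {y} l y∉l with memBox y l in eq
... | true = ⊥-elim (y∉l (memBox-sound y l eq))
... | false = refl

sameBox⇒∈ : ∀ x y T → sameBox x y T ≡ true → x ∈ concat T × y ∈ concat T
sameBox⇒∈ x y (B ∷ T) p with memBox x B ∧ memBox y B in both
... | true = ∈-++⁺ˡ (memBox-sound x B (∧-conicalˡ _ _ both)) , ∈-++⁺ˡ (memBox-sound y B (∧-conicalʳ _ _ both))
... | false with sameBox⇒∈ x y T p
...   | x∈T , y∈T = ∈-++⁺ʳ B x∈T , ∈-++⁺ʳ B y∈T

∉⇒no-sameBox : ∀ x y T → y ∉ concat T → sameBox x y T ≡ false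
∉⇒no-sameBox x y T y∉T with sameBox x y T in eq
... | true = ⊥-elim (y∉T (proj₂ (sameBox⇒∈ x y T eq)))
... | false = refl

Above : ℕ → List ℕ → Set
Above lo [] = ⊤
Above lo (x ∷ xs) = lo < x × Above x xs

Above-∈ : ∀ {lo y} l → Above lo l → y ∈ l → lo < y
Above-∈ (x ∷ l) (lo<x , _) (here refl) = lo<x
Above-∈ (x ∷ l) (lo<x , a) (there p) = <-trans lo<x (Above-∈ l a p)

Above-weaken : ∀ {lo lo'} l → lo' ≤ lo → Above lo l → Above lo' l
Above-weaken [] _ _ = tt
Above-weaken (x ∷ l) lo'≤lo (lo<x , a) = ≤-<-trans lo'≤lo lo<x , a

Sorted⇒Above : ∀ {lo} x r → lo < x → Sorted (x ∷ r) → Above lo (x ∷ r)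
Sorted⇒Above x [] lo<x _ = lo<x , tt
Sorted⇒Above x (y ∷ r) lo<x (x<y , s) = lo<x , Sorted⇒Above y r x<y s

Above⇒Sorted : ∀ {lo} l → Above lo l → Sorted l
Above⇒Sorted [] _ = tt
Above⇒Sorted (x ∷ []) _ = tt
Above⇒Sorted (x ∷ y ∷ r) (_ , a) = proj₁ a , Above⇒Sorted (y ∷ r) a

lastOr : ℕ → List ℕ → ℕ
lastOr d [] = d
lastOr d (x ∷ r) = lastOr x r

lastOr-≥ : ∀ d l → Above d l → d ≤ lastOr d l
lastOr-≥ d [] _ = ≤-refl
lastOr-≥ d (x ∷ l) (d<x , a) = ≤-trans (<⇒≤ d<x) (lastOr-≥ x l a)

lastOr-∈ : ∀ x l → lastOr x l ∈ x ∷ l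
lastOr-∈ x [] = here refl
lastOr-∈ x (y ∷ l) = there (lastOr-∈ y l)

lastOr-map : ∀ (g : ℕ → ℕ) d l → lastOr (g d) (map g l) ≡ g (lastOr d l)
lastOr-map g d [] = refl
lastOr-map g d (x ∷ l) = lastOr-map g x l

-- the largest entry of a box (boxes of a column are never empty)
boxMax : Box → ℕ
boxMax [] = 0
boxMax (x ∷ r) = lastOr x r

∈⇒NonEmpty : ∀ {y} B → y ∈ B → NonEmpty B
∈⇒NonEmpty (_ ∷ _) _ = tt

map-NonEmpty : ∀ (g : ℕ → ℕ) B → NonEmpty B → NonEmpty (map g B)
map-NonEmpty g (_ ∷ _) _ = tt

boxMax-∈ : ∀ B → NonEmpty B → boxMax B ∈ B
boxMax-∈ (x ∷ r) _ = lastOr-∈ x r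

boxMax-max : ∀ {lo y} B → Above lo B → y ∈ B → y ≤ boxMax B
boxMax-max (x ∷ r) (_ , a) (here refl) = lastOr-≥ x r a
boxMax-max (x ∷ r) (_ , a) (there p) = max-of-tail x r a p
  where
  max-of-tail : ∀ {y} d l → Above d l → y ∈ l → y ≤ lastOr d l
  max-of-tail d (x ∷ l) (_ , a) (here refl) = lastOr-≥ x l a
  max-of-tail d (x ∷ l) (_ , a) (there p) = max-of-tail x l a p

boxMax-unique : ∀ {lo m} B → Above lo B → m ∈ B → (∀ {y} → y ∈ B → y ≤ m) → boxMax B ≡ m
boxMax-unique B a m∈B bound =
  ≤-antisym (bound (boxMax-∈ B (∈⇒NonEmpty B m∈B))) (boxMax-max B a m∈B)

boxMax-map : ∀ (g : ℕ → ℕ) B → NonEmpty B → boxMax (map g B) ≡ g (boxMax B)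
boxMax-map g (x ∷ r) _ = lastOr-map g x r

ColumnAbove : ℕ → Column → Set
ColumnAbove lo [] = ⊤
ColumnAbove lo (B ∷ T) = NonEmpty B × Above lo B × ColumnAbove (boxMax B) T

maxima : Column → List ℕ
maxima = map boxMax

ColumnAbove⇒NonEmpty : ∀ {lo} T → ColumnAbove lo T → All NonEmpty T
ColumnAbove⇒NonEmpty [] _ = []
ColumnAbove⇒NonEmpty (B ∷ T) (ne , _ , c) = ne ∷ ColumnAbove⇒NonEmpty T c

ColumnAbove-weaken : ∀ {lo lo'} T → lo' ≤ lo → ColumnAbove lo T → ColumnAbove lo' T
ColumnAbove-weaken [] _ _ = tt
ColumnAbove-weaken (B ∷ T) lo'≤lo (ne , a , c) = ne , Above-weaken B lo'≤lo a , c

entries-above : ∀ {lo y} T → ColumnAbove lo T → y ∈ concat T → lo < y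
entries-above (B ∷ T) (ne , a , c) p with ∈-++⁻ B p
... | inj₁ q = Above-∈ B a q
... | inj₂ q = <-trans (Above-∈ B a (boxMax-∈ B ne)) (entries-above T c q)

maxima-Above : ∀ {lo} T → ColumnAbove lo T → Above lo (maxima T)
maxima-Above [] _ = tt
maxima-Above (B ∷ T) (ne , a , c) = Above-∈ B a (boxMax-∈ B ne) , maxima-Above T c

maxima⊆entries : ∀ {lo y} T → ColumnAbove lo T → y ∈ maxima T → y ∈ concat T
maxima⊆entries (B ∷ T) (ne , _ , _) (here refl) = ∈-++⁺ˡ (boxMax-∈ B ne)
maxima⊆entries (B ∷ T) (_ , _ , c) (there p) = ∈-++⁺ʳ B (maxima⊆entries T c p)

maxima-map : ∀ (g : ℕ → ℕ) T → All NonEmpty T → maxima (map (map g) T) ≡ map g (maxima T)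
maxima-map g [] _ = refl
maxima-map g (B ∷ T) (ne ∷ nes) = cong₂ _∷_ (boxMax-map g B ne) (maxima-map g T nes)

Above-++ : ∀ {lo} B C → NonEmpty B → Above lo (B ++ C) → Above lo B × Above (boxMax B) C
Above-++ (x ∷ []) C _ (lo<x , a) = (lo<x , tt) , a
Above-++ (x ∷ y ∷ r) C _ (lo<x , a) with Above-++ (y ∷ r) C tt a
... | a₁ , a₂ = (lo<x , a₁) , a₂

Above⇒ColumnAbove : ∀ {lo} T → All NonEmpty T → Above lo (concat T) → ColumnAbove lo T
Above⇒ColumnAbove [] _ _ = tt
Above⇒ColumnAbove (B ∷ T) (ne ∷ nes) a with Above-++ B (concat T) ne a
... | a₁ , a₂ = ne , a₁ , Above⇒ColumnAbove T nes a₂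

Valid⇒Above : ∀ {n k} T → Valid n k T → Above 0 (concat T)
Valid⇒Above T (_ , _ , s , bounds) with concat T
... | [] = tt
... | x ∷ r with bounds
...   | (1≤x , _) ∷ _ = Sorted⇒Above x r 1≤x s

Valid⇒ColumnAbove : ∀ {n k} T → Valid n k T → ColumnAbove 0 T
Valid⇒ColumnAbove T v = Above⇒ColumnAbove T (proj₁ (proj₂ v)) (Valid⇒Above T v)

gmaxFuel-stop : ∀ m g T → g T ≡ nothing → gmaxFuel m g T ≡ T
gmaxFuel-stop zero _ _ _ = refl
gmaxFuel-stop (suc m) g T stop rewrite stop = refl

gmax-stop : ∀ g T → g T ≡ nothing → gmax g T ≡ T
gmax-stop g T = gmaxFuel-stop (measure T) g T

-- a column with an entry has positive measure, so g^max performs at least one step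
measure-positive : ∀ {y} T → y ∈ concat T → Σ ℕ λ m → measure T ≡ suc m
measure-positive T p with concat T | p
... | x ∷ l | _ = sum (x ∷ l) + length l , +-suc (sum (x ∷ l)) (length l)

gmax-once : ∀ {y} g T T' → y ∈ concat T → g T ≡ just T' → g T' ≡ nothing → gmax g T ≡ T'
gmax-once g T T' y∈T step stop with measure-positive T y∈T
... | m , eq rewrite eq | step = gmaxFuel-stop m g T' stop

lower : ℕ → ℕ → ℕ
lower j x = if x ≡ᵇ suc j then j else x

j≢1+j : ∀ j → j ≢ suc j
j≢1+j j = <⇒≢ (n<1+n j)

lower-hit : ∀ j → lower j (suc j) ≡ j
lower-hit j rewrite ≡ᵇ-refl j = refl

lower-id : ∀ j x → x ≢ suc j → lower j x ≡ x
lower-id j x x≢ rewrite ≡ᵇ-false x (suc j) x≢ = refl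

lower-≤ : ∀ j x → lower j x ≤ x
lower-≤ j x with x ≟ suc j
... | yes refl rewrite lower-hit j = n≤1+n j
... | no x≢ rewrite lower-id j x x≢ = ≤-refl

lower-miss : ∀ j x → lower j x ≢ suc j
lower-miss j x with x ≟ suc j
... | yes refl rewrite lower-hit j = j≢1+j j
... | no x≢ rewrite lower-id j x x≢ = x≢

lower-mono : ∀ j {x y} → x ≤ y → lower j x ≤ lower j y
lower-mono j {x} {y} x≤y with x ≟ suc j | y ≟ suc j
... | yes refl | yes refl = ≤-refl
... | yes refl | no y≢ rewrite lower-hit j | lower-id j y y≢ = ≤-trans (n≤1+n j) x≤y
... | no x≢ | yes refl rewrite lower-hit j | lower-id j x x≢ = ≤-pred (≤∧≢⇒< x≤y x≢)
... | no x≢ | no y≢ rewrite lower-id j x x≢ | lower-id j y y≢ = x≤y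

lower-strict : ∀ j {x y} → x < y → x ≢ j → lower j x < lower j y
lower-strict j {x} {y} x<y x≢j with y ≟ suc j
... | yes refl rewrite lower-hit j | lower-id j x (<⇒≢ x<y) = ≤∧≢⇒< (≤-pred x<y) x≢j
... | no y≢ rewrite lower-id j y y≢ = ≤-<-trans (lower-≤ j x) x<y

map-lower-id : ∀ j xs → suc j ∉ xs → map (lower j) xs ≡ xs
map-lower-id j [] _ = refl
map-lower-id j (x ∷ xs) sj∉ =
  cong₂ _∷_ (lower-id j x (sj∉ ∘ here ∘ sym)) (map-lower-id j xs (sj∉ ∘ there))

Above-lower : ∀ j {lo} l → Above lo l → lo ≢ j → j ∉ l → Above (lower j lo) (map (lower j) l)
Above-lower j [] _ _ _ = tt
Above-lower j (x ∷ l) (lo<x , a) lo≢j j∉ =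
  lower-strict j lo<x lo≢j , Above-lower j l a (j∉ ∘ here ∘ sym) (j∉ ∘ there)

∈-removeVal⁻ : ∀ {x y} B → x ∈ removeVal y B → x ∈ B × x ≢ y
∈-removeVal⁻ {x} {y} (z ∷ B) p with z ≡ᵇ y in eq
... | true with ∈-removeVal⁻ B p
...   | x∈B , x≢y = there x∈B , x≢y
∈-removeVal⁻ {x} {y} (z ∷ B) (here refl) | false = here refl , λ { refl → z≢y refl }
  where
  z≢y : z ≢ y
  z≢y z≡y with trans (sym eq) (subst (λ t → (z ≡ᵇ t) ≡ true) z≡y (≡ᵇ-refl z))
  ... | ()
∈-removeVal⁻ {x} {y} (z ∷ B) (there p) | false with ∈-removeVal⁻ B p
... | x∈B , x≢y = there x∈B , x≢y

∈-removeVal⁺ : ∀ {x y} B → x ∈ B → x ≢ y → x ∈ removeVal y B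
∈-removeVal⁺ {x} {y} (z ∷ B) (here refl) x≢y rewrite ≡ᵇ-false x y x≢y = here refl
∈-removeVal⁺ {x} {y} (z ∷ B) (there p) x≢y with z ≡ᵇ y
... | true = ∈-removeVal⁺ B p x≢y
... | false = there (∈-removeVal⁺ B p x≢y)

removeVal-id : ∀ y B → y ∉ B → removeVal y B ≡ B
removeVal-id y [] _ = refl
removeVal-id y (x ∷ B) y∉ rewrite ≡ᵇ-false x y (y∉ ∘ here ∘ sym) =
  cong (x ∷_) (removeVal-id y B (y∉ ∘ there))

Above-removeVal : ∀ {lo} y B → Above lo B → Above lo (removeVal y B)
Above-removeVal y [] _ = tt
Above-removeVal y (x ∷ B) (lo<x , a) with x ≡ᵇ y
... | true = Above-weaken (removeVal y B) (<⇒≤ lo<x) (Above-removeVal y B a)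
... | false = lo<x , Above-removeVal y B a

boxMax-delete : ∀ j {lo} B → Above lo B → j ∈ B → suc j ∈ B →
                boxMax (removeVal (suc j) B) ≡ lower j (boxMax B)
boxMax-delete j B a j∈B sj∈B with boxMax B ≟ suc j
... | yes m≡sj rewrite m≡sj | lower-hit j =
  boxMax-unique B' (Above-removeVal (suc j) B a) (∈-removeVal⁺ B j∈B (j≢1+j j)) bound
  where
  B' : Box
  B' = removeVal (suc j) B
  bound : ∀ {y} → y ∈ B' → y ≤ j
  bound p with ∈-removeVal⁻ B p
  ... | y∈B , y≢sj = ≤-pred (≤∧≢⇒< (subst (_ ≤_) m≡sj (boxMax-max B a y∈B)) y≢sj)
... | no m≢sj rewrite lower-id j (boxMax B) m≢sj =
  boxMax-unique B' (Above-removeVal (suc j) B a) (∈-removeVal⁺ B (boxMax-∈ B (∈⇒NonEmpty B j∈B)) m≢sj) bound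
  where
  B' : Box
  B' = removeVal (suc j) B
  bound : ∀ {y} → y ∈ B' → y ≤ boxMax B
  bound p = boxMax-max B a (proj₁ (∈-removeVal⁻ B p))

-- e_j T = just (lowerAll j T) when eApplicable j T, and e^K_j T = just (deleteAll j T)
-- when j and j+1 share a box
lowerAll : ℕ → Column → Column
lowerAll j = map (map (lower j))

deleteAll : ℕ → Column → Column
deleteAll j = map (removeVal (suc j))

stepCol : ℕ → Column → Column
stepCol j T = gmax (eK j) (gmax (e j) T)

eApplicable : ℕ → Column → Bool
eApplicable j T = mem (suc j) T ∧ not (mem j T)

lowerAll-no-suc : ∀ j T → suc j ∉ concat (lowerAll j T)
lowerAll-no-suc j T p with ∈-map⁻ (lower j) (subst (suc j ∈_) (concat-map T) p)
... | x , _ , sj≡ = lower-miss j x (sym sj≡)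

deleteAll-no-sameBox : ∀ j T → sameBox j (suc j) (deleteAll j T) ≡ false
deleteAll-no-sameBox j [] = refl
deleteAll-no-sameBox j (B ∷ T)
  rewrite ∧-falseʳ (memBox j (removeVal (suc j) B))
                   (∉⇒memBox-false (removeVal (suc j) B) (λ p → proj₂ (∈-removeVal⁻ B p) refl)) =
  deleteAll-no-sameBox j T

-- If e_j applies, it applies once (j+1 becomes j) and e^K_j has nothing to delete.
stepCol-e : ∀ j T → eApplicable j T ≡ true → stepCol j T ≡ lowerAll j T
stepCol-e j T app = begin
  gmax (eK j) (gmax (e j) T)  ≡⟨ cong (gmax (eK j)) (gmax-once (e j) T (lowerAll j T) sj∈T (if-true app) e-stops) ⟩
  gmax (eK j) (lowerAll j T)  ≡⟨ gmax-stop (eK j) (lowerAll j T) (if-false eK-stops) ⟩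
  lowerAll j T                ∎
  where
  sj∈T : suc j ∈ concat T
  sj∈T = memBox-sound (suc j) (concat T) (∧-conicalˡ _ _ app)
  e-stops : e j (lowerAll j T) ≡ nothing
  e-stops = if-false (∧-falseˡ _ (∉⇒memBox-false _ (lowerAll-no-suc j T)))
  eK-stops : sameBox j (suc j) (lowerAll j T) ≡ false
  eK-stops = ∉⇒no-sameBox j (suc j) (lowerAll j T) (lowerAll-no-suc j T)

stepCol-eK : ∀ j T → eApplicable j T ≡ false → sameBox j (suc j) T ≡ true → stepCol j T ≡ deleteAll j T
stepCol-eK j T ¬app same = begin
  gmax (eK j) (gmax (e j) T)  ≡⟨ cong (gmax (eK j)) (gmax-stop (e j) T (if-false ¬app)) ⟩
  gmax (eK j) T               ≡⟨ gmax-once (eK j) T (deleteAll j T) sj∈T (if-true same) (if-false (deleteAll-no-sameBox j T)) ⟩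
  deleteAll j T               ∎
  where
  sj∈T : suc j ∈ concat T
  sj∈T = proj₂ (sameBox⇒∈ j (suc j) T same)

stepCol-id : ∀ j T → eApplicable j T ≡ false → sameBox j (suc j) T ≡ false → stepCol j T ≡ T
stepCol-id j T ¬app apart = begin
  gmax (eK j) (gmax (e j) T)  ≡⟨ cong (gmax (eK j)) (gmax-stop (e j) T (if-false ¬app)) ⟩
  gmax (eK j) T               ≡⟨ gmax-stop (eK j) T (if-false apart) ⟩
  T                           ∎

-- the action of the step on the list of box maxima
lowerMax : ℕ → List ℕ → List ℕ
lowerMax j xs = if memBox (suc j) xs ∧ not (memBox j xs) then map (lower j) xs else xs

lowerMax-absent : ∀ j xs → j ∉ xs → lowerMax j xs ≡ map (lower j) xs
lowerMax-absent j xs j∉ rewrite ∉⇒memBox-false xs j∉ with memBox (suc j) xs in sj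
... | true = refl
... | false = sym (map-lower-id j xs (memBox-false⇒∉ sj))

lowerMax-present : ∀ j xs → j ∈ xs → lowerMax j xs ≡ xs
lowerMax-present j xs j∈ rewrite memBox-complete j∈ with memBox (suc j) xs
... | true = refl
... | false = refl

lowerMax-no-suc : ∀ j xs → suc j ∉ xs → lowerMax j xs ≡ xs
lowerMax-no-suc j xs sj∉ rewrite ∉⇒memBox-false xs sj∉ = refl

ColumnAbove-lowerAll : ∀ j {lo} T → ColumnAbove lo T → lo ≢ j → j ∉ concat T →
                       ColumnAbove (lower j lo) (lowerAll j T)
ColumnAbove-lowerAll j [] _ _ _ = tt
ColumnAbove-lowerAll j (B ∷ T) (ne , a , c) lo≢j j∉ =
  map-NonEmpty (lower j) B ne ,
  Above-lower j B a lo≢j (j∉ ∘ ∈-++⁺ˡ) ,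
  subst (λ m → ColumnAbove m (lowerAll j T)) (sym (boxMax-map (lower j) B ne))
        (ColumnAbove-lowerAll j T c m≢j (j∉ ∘ ∈-++⁺ʳ B))
  where
  m≢j : boxMax B ≢ j
  m≢j m≡j = j∉ (∈-++⁺ˡ (subst (_∈ B) m≡j (boxMax-∈ B ne)))

ColumnAbove-deleteAll : ∀ j {lo} T → ColumnAbove lo T → sameBox j (suc j) T ≡ true →
  ColumnAbove lo (deleteAll j T) × maxima (deleteAll j T) ≡ map (lower j) (maxima T) × j ∉ maxima T
ColumnAbove-deleteAll j (B ∷ T) (ne , a , c) same with memBox j B ∧ memBox (suc j) B in both
... | true =
  subst (λ R → ColumnAbove _ (B' ∷ R)) (sym rest-kept)
        (∈⇒NonEmpty B' j∈B' , Above-removeVal (suc j) B a ,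
         ColumnAbove-weaken T (subst (_≤ boxMax B) (sym max-lowered) (lower-≤ j _)) c) ,
  cong₂ _∷_ max-lowered (trans (cong maxima rest-kept) (sym (map-lower-id j (maxima T) (sj∉T ∘ maxima⊆entries T c)))) ,
  j∉maxima
  where
  B' : Box
  B' = removeVal (suc j) B
  j∈B : j ∈ B
  j∈B = memBox-sound j B (∧-conicalˡ _ _ both)
  sj∈B : suc j ∈ B
  sj∈B = memBox-sound (suc j) B (∧-conicalʳ _ _ both)
  j∈B' : j ∈ B'
  j∈B' = ∈-removeVal⁺ B j∈B (j≢1+j j)
  sj≤m : suc j ≤ boxMax B
  sj≤m = boxMax-max B a sj∈B
  max-lowered : boxMax B' ≡ lower j (boxMax B)
  max-lowered = boxMax-delete j B a j∈B sj∈B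
  sj∉T : suc j ∉ concat T
  sj∉T p = <-irrefl refl (≤-<-trans sj≤m (entries-above T c p))
  rest-kept : deleteAll j T ≡ T
  rest-kept = map-removeVal-id T sj∉T
    where
    map-removeVal-id : ∀ R → suc j ∉ concat R → deleteAll j R ≡ R
    map-removeVal-id [] _ = refl
    map-removeVal-id (C ∷ R) ∉R =
      cong₂ _∷_ (removeVal-id (suc j) C (∉R ∘ ∈-++⁺ˡ)) (map-removeVal-id R (∉R ∘ ∈-++⁺ʳ C))
  j∉maxima : j ∉ maxima (B ∷ T)
  j∉maxima (here j≡m) = <-irrefl j≡m (<-≤-trans (n<1+n j) sj≤m)
  j∉maxima (there p) = <-irrefl refl (<-trans (n<1+n j) (≤-<-trans sj≤m (Above-∈ _ (maxima-Above T c) p)))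
... | false with ColumnAbove-deleteAll j T c same
...   | c' , maxima-eq , j∉rest =
  subst (λ B'' → ColumnAbove _ (B'' ∷ deleteAll j T)) (sym B-kept) (ne , a , c') ,
  cong₂ _∷_ (trans (cong boxMax B-kept) (sym (lower-id j (boxMax B) m≢sj))) maxima-eq ,
  j∉maxima
  where
  m<j : boxMax B < j
  m<j = entries-above T c (proj₁ (sameBox⇒∈ j (suc j) T same))
  m≢sj : boxMax B ≢ suc j
  m≢sj m≡sj = <-irrefl m≡sj (<-trans m<j (n<1+n j))
  B-kept : removeVal (suc j) B ≡ B
  B-kept = removeVal-id (suc j) B (λ p → <-irrefl refl (<-trans (≤-<-trans (boxMax-max B a p) m<j) (n<1+n j)))
  j∉maxima : j ∉ maxima (B ∷ T)
  j∉maxima (here j≡m) = <-irrefl (sym j≡m) m<j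
  j∉maxima (there p) = j∉rest p

adjacent-maximum : ∀ j {lo} T → ColumnAbove lo T → j ∈ concat T → suc j ∈ concat T →
                   sameBox j (suc j) T ≡ false → j ∈ maxima T
adjacent-maximum j (B ∷ T) (ne , a , c) j∈ sj∈ apart with ∈-++⁻ B j∈ | ∈-++⁻ B sj∈
... | inj₁ j∈B | inj₁ sj∈B rewrite memBox-complete j∈B | memBox-complete sj∈B with apart
...   | ()
adjacent-maximum j (B ∷ T) (ne , a , c) j∈ sj∈ apart | inj₁ j∈B | inj₂ sj∈T =
  here (≤-antisym (boxMax-max B a j∈B) (≤-pred (entries-above T c sj∈T)))
adjacent-maximum j (B ∷ T) (ne , a , c) j∈ sj∈ apart | inj₂ j∈T | inj₁ sj∈B =
  ⊥-elim (<-irrefl refl (<-trans (n<1+n j) (≤-<-trans (boxMax-max B a sj∈B) (entries-above T c j∈T))))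
adjacent-maximum j (B ∷ T) (ne , a , c) j∈ sj∈ apart | inj₂ j∈T | inj₂ sj∈T =
  there (adjacent-maximum j T c j∈T sj∈T (∨-conicalʳ _ _ apart))

step-maxima : ∀ j T → 0 ≢ j → ColumnAbove 0 T →
              ColumnAbove 0 (stepCol j T) × maxima (stepCol j T) ≡ lowerMax j (maxima T)
step-maxima j T 0≢j c with eApplicable j T in app
... | true rewrite stepCol-e j T app =
  ColumnAbove-lowerAll j T c 0≢j j∉T ,
  trans (maxima-map (lower j) T (ColumnAbove⇒NonEmpty T c))
        (sym (lowerMax-absent j (maxima T) (j∉T ∘ maxima⊆entries T c)))
  where
  j∉T : j ∉ concat T
  j∉T = memBox-false⇒∉ (not-true (∧-conicalʳ _ _ app))
... | false with sameBox j (suc j) T in same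
...   | true rewrite stepCol-eK j T app same with ColumnAbove-deleteAll j T c same
...     | c' , maxima-eq , j∉ = c' , trans maxima-eq (sym (lowerMax-absent j (maxima T) j∉))
step-maxima j T 0≢j c | false | false rewrite stepCol-id j T app same with mem (suc j) T in sj
... | false = c , sym (lowerMax-no-suc j (maxima T) (memBox-false⇒∉ sj ∘ maxima⊆entries T c))
... | true = c , sym (lowerMax-present j (maxima T) (adjacent-maximum j T c j∈T sj∈T same))
  where
  j∈T : j ∈ concat T
  j∈T = memBox-sound j (concat T) (not-false app)
  sj∈T : suc j ∈ concat T
  sj∈T = memBox-sound (suc j) (concat T) sj

lowerMaxWord : List ℕ → List ℕ → List ℕ
lowerMaxWord [] xs = xs
lowerMaxWord (j ∷ w) xs = lowerMaxWord w (lowerMax j xs)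

1≤⇒0≢ : ∀ {j} → 1 ≤ j → 0 ≢ j
1≤⇒0≢ 1≤j = ≢-sym (m<n⇒n≢0 1≤j)

reduceWord-maxima : ∀ w T → All (1 ≤_) w → ColumnAbove 0 T →
  ColumnAbove 0 (reduceWord w T) × maxima (reduceWord w T) ≡ lowerMaxWord w (maxima T)
reduceWord-maxima [] T _ c = c , refl
reduceWord-maxima (j ∷ w) T (1≤j ∷ pos) c with step-maxima j T (1≤⇒0≢ 1≤j) c
... | c' , maxima-eq with reduceWord-maxima w (stepCol j T) pos c'
...   | c'' , maxima-eq' = c'' , trans maxima-eq' (cong (lowerMaxWord w) maxima-eq)

-- Membership in SVT_w is decided by the maxima

ascending : ℕ → List ℕ
ascending k = map suc (upTo k)

Consecutive : ℕ → List ℕ → Set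
Consecutive a [] = ⊤
Consecutive a (y ∷ Y) = y ≡ suc a × Consecutive y Y

ascending-Consecutive : ∀ k → Consecutive 0 (ascending k)
ascending-Consecutive k =
  subst (Consecutive 0) (sym (map-applyUpTo id suc k)) (applyUpTo-Consecutive suc 0 k (λ _ → refl))
  where
  applyUpTo-Consecutive : ∀ (g : ℕ → ℕ) a k → (∀ x → g x ≡ suc (a + x)) → Consecutive a (applyUpTo g k)
  applyUpTo-Consecutive g a zero _ = tt
  applyUpTo-Consecutive g a (suc k) g≡ =
    g0 , subst (λ z → Consecutive z (applyUpTo (g ∘ suc) k)) (sym g0)
               (applyUpTo-Consecutive (g ∘ suc) (suc a) k (λ x → trans (g≡ (suc x)) (cong suc (+-suc a x))))
    where
    g0 : g 0 ≡ suc a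
    g0 = trans (g≡ 0) (cong suc (+-identityʳ a))

column-from-maxima : ∀ a T Y → ColumnAbove a T → Consecutive a Y → maxima T ≡ Y → T ≡ map (_∷ []) Y
column-from-maxima a [] [] _ _ _ = refl
column-from-maxima a ((x ∷ []) ∷ T) (y ∷ Y) (_ , _ , c) (refl , cY) refl =
  cong ((x ∷ []) ∷_) (column-from-maxima x T Y c cY refl)
column-from-maxima a ((x ∷ z ∷ r) ∷ T) (y ∷ Y) (_ , (a<x , x<z , az) , _) (y≡ , _) maxima-eq =
  ⊥-elim (<-irrefl (sym y≡) (<-≤-trans (≤-<-trans a<x x<z) (≤-trans (lastOr-≥ z r az) (≤-reflexive (proj₁ (∷-injective maxima-eq))))))

maxima-u : ∀ k → maxima (u k) ≡ ascending k
maxima-u k = sym (map-∘ (upTo k))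

u-singletons : ∀ k → u k ≡ map (_∷ []) (ascending k)
u-singletons k = map-∘ (upTo k)

reaches-u⇒ : ∀ w k T → All (1 ≤_) w → ColumnAbove 0 T →
             reduceWord w T ≡ u k → lowerMaxWord w (maxima T) ≡ ascending k
reaches-u⇒ w k T pos c reaches = begin
  lowerMaxWord w (maxima T)  ≡⟨ sym (proj₂ (reduceWord-maxima w T pos c)) ⟩
  maxima (reduceWord w T)    ≡⟨ cong maxima reaches ⟩
  maxima (u k)               ≡⟨ maxima-u k ⟩
  ascending k                ∎

reaches-u⇐ : ∀ w k T → All (1 ≤_) w → ColumnAbove 0 T →
             lowerMaxWord w (maxima T) ≡ ascending k → reduceWord w T ≡ u k
reaches-u⇐ w k T pos c lowered with reduceWord-maxima w T pos c
... | c' , maxima-eq = begin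
  reduceWord w T               ≡⟨ column-from-maxima 0 _ _ c' (ascending-Consecutive k) (trans maxima-eq lowered) ⟩
  map (_∷ []) (ascending k)    ≡⟨ sym (u-singletons k) ⟩
  u k                          ∎

-- Monotonicity of lowering the maxima

_≤*_ : List ℕ → List ℕ → Set
_≤*_ = Pointwise _≤_

≤*-refl : ∀ xs → xs ≤* xs
≤*-refl [] = []
≤*-refl (x ∷ xs) = ≤-refl ∷ ≤*-refl xs

≤*-trans : ∀ {xs ys zs} → xs ≤* ys → ys ≤* zs → xs ≤* zs
≤*-trans [] [] = []
≤*-trans (p ∷ ps) (q ∷ qs) = ≤-trans p q ∷ ≤*-trans ps qs

map-≤* : ∀ (g : ℕ → ℕ) xs → (∀ x → x ≤ g x) → xs ≤* map g xs
map-≤* g [] _ = []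
map-≤* g (x ∷ xs) x≤gx = x≤gx x ∷ map-≤* g xs x≤gx

map-lower-≤* : ∀ j xs → map (lower j) xs ≤* xs
map-lower-≤* j [] = []
map-lower-≤* j (x ∷ xs) = lower-≤ j x ∷ map-lower-≤* j xs

map-lower-mono : ∀ j {xs ys} → xs ≤* ys → map (lower j) xs ≤* map (lower j) ys
map-lower-mono j [] = []
map-lower-mono j (p ∷ ps) = lower-mono j p ∷ map-lower-mono j ps

lowerMax-≤* : ∀ j xs → lowerMax j xs ≤* xs
lowerMax-≤* j xs with j ∈? xs
... | yes j∈ = subst (_≤* xs) (sym (lowerMax-present j xs j∈)) (≤*-refl xs)
... | no j∉ = subst (_≤* xs) (sym (lowerMax-absent j xs j∉)) (map-lower-≤* j xs)

lowerMax-Above : ∀ j xs → 0 ≢ j → Above 0 xs → Above 0 (lowerMax j xs)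
lowerMax-Above j xs 0≢j a with j ∈? xs
... | yes j∈ = subst (Above 0) (sym (lowerMax-present j xs j∈)) a
... | no j∉ = subst (Above 0) (sym (lowerMax-absent j xs j∉)) (Above-lower j xs a 0≢j j∉)

-- One position of lower-keeps-≤*: an entry x₀ of x below y₀ = j+1 cannot be
-- j+1 itself, since j occurs in x before x₀ (or below the current bound a ≤ c)
-- while j does not occur in y.
lower-head-≤ : ∀ j {a c} x₀ xs y₀ → Above x₀ xs → c < y₀ → a ≤ c → c ≢ j → x₀ ≤ y₀ →
               (j ∈ x₀ ∷ xs ⊎ j ≤ a) → x₀ ≤ lower j y₀
lower-head-≤ j x₀ xs y₀ ax c<y₀ a≤c c≢j x₀≤y₀ seen with y₀ ≟ suc j
... | no y₀≢ rewrite lower-id j y₀ y₀≢ = x₀≤y₀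
... | yes refl rewrite lower-hit j with m≤n⇒m<n∨m≡n x₀≤y₀
...   | inj₁ x₀<sj = ≤-pred x₀<sj
...   | inj₂ refl with seen
...     | inj₁ (here j≡) = ⊥-elim (j≢1+j j j≡)
...     | inj₁ (there j∈xs) = ⊥-elim (<-irrefl refl (<-trans (n<1+n j) (Above-∈ xs ax j∈xs)))
...     | inj₂ j≤a = ⊥-elim (c≢j (≤-antisym (≤-pred c<y₀) (≤-trans j≤a a≤c)))

lower-keeps-≤* : ∀ j {a c} x y → Above a x → Above c y → a ≤ c → c ≢ j → j ∉ y → x ≤* y →
                 (j ∈ x ⊎ j ≤ a) → x ≤* map (lower j) y
lower-keeps-≤* j [] [] _ _ _ _ _ [] _ = []
lower-keeps-≤* j (x₀ ∷ xs) (y₀ ∷ ys) (a<x₀ , ax) (c<y₀ , ay) a≤c c≢j j∉y (x₀≤y₀ ∷ le) seen =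
  lower-head-≤ j x₀ xs y₀ ax c<y₀ a≤c c≢j x₀≤y₀ seen ∷
  lower-keeps-≤* j xs ys ax ay x₀≤y₀ (j∉y ∘ here ∘ sym) (j∉y ∘ there) le (seen-next seen)
  where
  seen-next : j ∈ x₀ ∷ xs ⊎ j ≤ _ → j ∈ xs ⊎ j ≤ x₀
  seen-next (inj₁ (here j≡x₀)) = inj₂ (≤-reflexive j≡x₀)
  seen-next (inj₁ (there j∈xs)) = inj₁ j∈xs
  seen-next (inj₂ j≤a) = inj₂ (<⇒≤ (≤-<-trans j≤a a<x₀))

lowerMax-mono : ∀ j {xs ys} → 0 ≢ j → Above 0 xs → Above 0 ys → xs ≤* ys → lowerMax j xs ≤* lowerMax j ys
lowerMax-mono j {xs} {ys} 0≢j axs ays le with j ∈? ys | j ∈? xs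
... | yes j∈ys | _ =
  subst (lowerMax j xs ≤*_) (sym (lowerMax-present j ys j∈ys)) (≤*-trans (lowerMax-≤* j xs) le)
... | no j∉ys | yes j∈xs =
  subst₂ _≤*_ (sym (lowerMax-present j xs j∈xs)) (sym (lowerMax-absent j ys j∉ys))
         (lower-keeps-≤* j xs ys axs ays z≤n 0≢j j∉ys le (inj₁ j∈xs))
... | no j∉ys | no j∉xs =
  subst₂ _≤*_ (sym (lowerMax-absent j xs j∉xs)) (sym (lowerMax-absent j ys j∉ys)) (map-lower-mono j le)

lowerMaxWord-Above : ∀ w xs → All (1 ≤_) w → Above 0 xs → Above 0 (lowerMaxWord w xs)
lowerMaxWord-Above [] xs _ a = a
lowerMaxWord-Above (j ∷ w) xs (1≤j ∷ pos) a =
  lowerMaxWord-Above w (lowerMax j xs) pos (lowerMax-Above j xs (1≤⇒0≢ 1≤j) a)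

lowerMaxWord-mono : ∀ w {xs ys} → All (1 ≤_) w → Above 0 xs → Above 0 ys → xs ≤* ys →
                    lowerMaxWord w xs ≤* lowerMaxWord w ys
lowerMaxWord-mono [] _ _ _ le = le
lowerMaxWord-mono (j ∷ w) {xs} {ys} (1≤j ∷ pos) axs ays le =
  lowerMaxWord-mono w pos (lowerMax-Above j xs 0≢j axs) (lowerMax-Above j ys 0≢j ays)
                    (lowerMax-mono j 0≢j axs ays le)
  where
  0≢j : 0 ≢ j
  0≢j = 1≤⇒0≢ 1≤j

Consecutive-squeeze : ∀ a xs Y → Consecutive a Y → Above a xs → xs ≤* Y → xs ≡ Y
Consecutive-squeeze a [] [] _ _ [] = refl
Consecutive-squeeze a (x ∷ xs) (y ∷ Y) (refl , cY) (a<x , ax) (x≤y ∷ le) with ≤-antisym x≤y a<x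
... | refl = cong (x ∷_) (Consecutive-squeeze x xs Y cY ax le)

svtw-same-maxima : ∀ {n k w X Y} → All (1 ≤_) w → Valid n k X → Valid n k Y →
                   maxima X ≡ maxima Y → SVTw n k w X → SVTw n k w Y
svtw-same-maxima {k = k} {w} {X} {Y} pos vX vY same (_ , reaches) =
  vY , reaches-u⇐ w k Y pos (Valid⇒ColumnAbove Y vY)
         (trans (cong (lowerMaxWord w) (sym same)) (reaches-u⇒ w k X pos (Valid⇒ColumnAbove X vX) reaches))

svtw-below : ∀ {n k w X Y} → All (1 ≤_) w → Valid n k X → Valid n k Y →
             maxima X ≤* maxima Y → SVTw n k w Y → SVTw n k w X
svtw-below {k = k} {w} {X} {Y} pos vX vY le (_ , reaches) =
  vX , reaches-u⇐ w k X pos cX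
         (Consecutive-squeeze 0 _ _ (ascending-Consecutive k)
           (lowerMaxWord-Above w (maxima X) pos (maxima-Above X cX))
           (subst (lowerMaxWord w (maxima X) ≤*_) (reaches-u⇒ w k Y pos cY reaches)
             (lowerMaxWord-mono w pos (maxima-Above X cX) (maxima-Above Y cY) le)))
  where
  cX : ColumnAbove 0 X
  cX = Valid⇒ColumnAbove X vX
  cY : ColumnAbove 0 Y
  cY = Valid⇒ColumnAbove Y vY

decide-SVTw : ∀ {n k} w T → Valid n k T → Dec (SVTw n k w T)
decide-SVTw {k = k} w T v = map′ (v ,_) proj₂ (≡-dec (≡-dec _≟_) (reduceWord w T) (u k))

raise : ℕ → ℕ → ℕ
raise i x = if x ≡ᵇ i then suc i else x

kSplit : ℕ → ℕ → List ℕ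
kSplit i x = if x ≡ᵇ i then i ∷ suc i ∷ [] else x ∷ []

-- f_i T = just (raiseCol i T) and f^K_i T = just (splitCol i T) when fApplicable i T
raiseCol : ℕ → Column → Column
raiseCol i = map (map (raise i))

splitCol : ℕ → Column → Column
splitCol i = map (concatMap (kSplit i))

fApplicable : ℕ → Column → Bool
fApplicable i T = mem i T ∧ not (mem (suc i) T)

raise-hit : ∀ i → raise i i ≡ suc i
raise-hit i rewrite ≡ᵇ-refl i = refl

raise-id : ∀ i x → x ≢ i → raise i x ≡ x
raise-id i x x≢ rewrite ≡ᵇ-false x i x≢ = refl

raise-≥ : ∀ i x → x ≤ raise i x
raise-≥ i x with x ≟ i
... | yes refl rewrite raise-hit x = n≤1+n x
... | no x≢ rewrite raise-id i x x≢ = ≤-refl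

raise-miss : ∀ i x → raise i x ≢ i
raise-miss i x with x ≟ i
... | yes refl rewrite raise-hit x = ≢-sym (j≢1+j x)
... | no x≢ rewrite raise-id i x x≢ = x≢

kSplit-hit : ∀ i → kSplit i i ≡ i ∷ suc i ∷ []
kSplit-hit i rewrite ≡ᵇ-refl i = refl

kSplit-id : ∀ i x → x ≢ i → kSplit i x ≡ x ∷ []
kSplit-id i x x≢ rewrite ≡ᵇ-false x i x≢ = refl

raise-strict : ∀ i {x y} → x < y → y ≢ suc i → raise i x < raise i y
raise-strict i {x} {y} x<y y≢ with x ≟ i
... | yes refl rewrite raise-hit x | raise-id x y (≢-sym (<⇒≢ x<y)) = ≤∧≢⇒< x<y (≢-sym y≢)
... | no x≢ rewrite raise-id i x x≢ = <-≤-trans x<y (raise-≥ i y)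

Above-raise : ∀ i {lo} l → Above lo l → suc i ∉ l → Above lo (map (raise i) l)
Above-raise i [] _ _ = tt
Above-raise i (x ∷ l) (lo<x , a) sj∉ = <-≤-trans lo<x (raise-≥ i x) , raised x l a (sj∉ ∘ there)
  where
  raised : ∀ x l → Above x l → suc i ∉ l → Above (raise i x) (map (raise i) l)
  raised x [] _ _ = tt
  raised x (y ∷ l) (x<y , a) sj∉ = raise-strict i x<y (sj∉ ∘ here ∘ sym) , raised y l a (sj∉ ∘ there)

Above-succ : ∀ x l → Above x l → suc x ∉ l → Above (suc x) l
Above-succ x [] _ _ = tt
Above-succ x (y ∷ l) (x<y , a) sx∉ = ≤∧≢⇒< x<y (sx∉ ∘ here) , a

Above-kSplit : ∀ i {lo} l → Above lo l → suc i ∉ l → Above lo (concatMap (kSplit i) l)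
Above-kSplit i [] _ _ = tt
Above-kSplit i (x ∷ l) (lo<x , a) si∉ with x ≟ i
... | yes refl rewrite kSplit-hit x =
  lo<x , n<1+n x , Above-kSplit x l (Above-succ x l a (si∉ ∘ there)) (si∉ ∘ there)
... | no x≢ rewrite kSplit-id i x x≢ = lo<x , Above-kSplit i l a (si∉ ∘ there)

kSplit-NonEmpty : ∀ i B → NonEmpty B → NonEmpty (concatMap (kSplit i) B)
kSplit-NonEmpty i (x ∷ r) _ with x ≟ i
... | yes refl rewrite kSplit-hit x = tt
... | no x≢ rewrite kSplit-id i x x≢ = tt

∈-kSplit : ∀ i l → i ∈ l → suc i ∈ concatMap (kSplit i) l
∈-kSplit i (x ∷ l) (here refl) rewrite kSplit-hit x = there (here refl)
∈-kSplit i (x ∷ l) (there p) = ∈-++⁺ʳ (kSplit i x) (∈-kSplit i l p)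

concat-splitCol : ∀ i T → concat (splitCol i T) ≡ concatMap (kSplit i) (concat T)
concat-splitCol i [] = refl
concat-splitCol i (B ∷ T) = begin
  concatMap (kSplit i) B ++ concat (splitCol i T)        ≡⟨ cong (concatMap (kSplit i) B ++_) (concat-splitCol i T) ⟩
  concatMap (kSplit i) B ++ concatMap (kSplit i) (concat T) ≡⟨ sym (concatMap-++ (kSplit i) B (concat T)) ⟩
  concatMap (kSplit i) (B ++ concat T)                   ∎

InRange : ℕ → ℕ → Set
InRange n x = 1 ≤ x × x ≤ n

raise-InRange : ∀ {n} i x → i < n → InRange n x → InRange n (raise i x)
raise-InRange i x i<n (1≤x , x≤n) with x ≟ i
... | yes refl rewrite raise-hit x = ≤-trans 1≤x (n≤1+n x) , i<n
... | no x≢ rewrite raise-id i x x≢ = 1≤x , x≤n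

kSplit-InRange : ∀ {n} i x → i < n → InRange n x → All (InRange n) (kSplit i x)
kSplit-InRange i x i<n (1≤x , x≤n) with x ≟ i
... | yes refl rewrite kSplit-hit x = (1≤x , x≤n) ∷ (≤-trans 1≤x (n≤1+n x) , i<n) ∷ []
... | no x≢ rewrite kSplit-id i x x≢ = (1≤x , x≤n) ∷ []

Valid-raiseCol : ∀ {n k} i b → i < n → Valid n k b → suc i ∉ concat b → Valid n k (raiseCol i b)
Valid-raiseCol i b i<n v@(len , nes , _ , bounds) si∉ =
  trans (length-map _ b) len ,
  map⁺ (All.map (λ {B} → map-NonEmpty (raise i) B) nes) ,
  subst Sorted (sym (concat-map b)) (Above⇒Sorted _ (Above-raise i (concat b) (Valid⇒Above b v) si∉)) ,
  subst (All (InRange _)) (sym (concat-map b)) (map⁺ (All.map (λ {x} → raise-InRange i x i<n) bounds))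

Valid-splitCol : ∀ {n k} i b → i < n → Valid n k b → suc i ∉ concat b → Valid n k (splitCol i b)
Valid-splitCol i b i<n v@(len , nes , _ , bounds) si∉ =
  trans (length-map _ b) len ,
  map⁺ (All.map (λ {B} → kSplit-NonEmpty i B) nes) ,
  subst Sorted (sym (concat-splitCol i b)) (Above⇒Sorted _ (Above-kSplit i (concat b) (Valid⇒Above b v) si∉)) ,
  subst (All (InRange _)) (sym (concat-splitCol i b)) (concat⁺ (map⁺ (All.map (λ {x} → kSplit-InRange i x i<n) bounds)))

lastOr-kSplit : ∀ i d r → lastOr (raise i d) (concatMap (kSplit i) r) ≡ raise i (lastOr d r)
lastOr-kSplit i d [] = refl
lastOr-kSplit i d (y ∷ r) with y ≟ i
... | yes refl rewrite kSplit-hit y =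
  trans (cong (λ z → lastOr z (concatMap (kSplit y) r)) (sym (raise-hit y))) (lastOr-kSplit y y r)
... | no y≢ rewrite kSplit-id i y y≢ =
  trans (cong (λ z → lastOr z (concatMap (kSplit i) r)) (sym (raise-id i y y≢))) (lastOr-kSplit i y r)

boxMax-as-lastOr : ∀ d B → NonEmpty B → boxMax B ≡ lastOr d B
boxMax-as-lastOr d (_ ∷ _) _ = refl

boxMax-kSplit : ∀ i B → NonEmpty B → boxMax (concatMap (kSplit i) B) ≡ raise i (boxMax B)
boxMax-kSplit i B@(x ∷ r) ne =
  trans (boxMax-as-lastOr (raise i 0) _ (kSplit-NonEmpty i B ne)) (lastOr-kSplit i 0 B)

maxima-splitCol : ∀ i T → All NonEmpty T → maxima (splitCol i T) ≡ maxima (raiseCol i T)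
maxima-splitCol i [] _ = refl
maxima-splitCol i (B ∷ T) (ne ∷ nes) =
  cong₂ _∷_ (trans (boxMax-kSplit i B ne) (sym (boxMax-map (raise i) B ne))) (maxima-splitCol i T nes)

maxima-below-raiseCol : ∀ i T → All NonEmpty T → maxima T ≤* maxima (raiseCol i T)
maxima-below-raiseCol i T nes =
  subst (maxima T ≤*_) (sym (maxima-map (raise i) T nes)) (map-≤* (raise i) (maxima T) (raise-≥ i))

fpow-stuck : ∀ i a X T → f i X ≡ nothing → fpow i a X ≡ just T → T ≡ X
fpow-stuck i zero X T _ refl = refl
fpow-stuck i (suc a) X T stop p with fpow i a X in q
... | just Y with fpow-stuck i a X Y stop q
...   | refl with trans (sym stop) p
...     | ()

fpow-two : ∀ i a X Y T → f i X ≡ just Y → f i Y ≡ nothing → fpow i a X ≡ just T → T ≡ X ⊎ T ≡ Y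
fpow-two i zero X Y T _ _ refl = inj₁ refl
fpow-two i (suc a) X Y T step stop p with fpow i a X in q
... | just Z with fpow-two i a X Y Z step stop q
...   | inj₁ refl = inj₂ (just-injective (trans (sym p) step))
...   | inj₂ refl with trans (sym stop) p
...     | ()

f-raiseCol-stuck : ∀ i b → f i (raiseCol i b) ≡ nothing
f-raiseCol-stuck i b = if-false (∧-falseˡ _ (∉⇒memBox-false _ i∉))
  where
  i∉ : i ∉ concat (raiseCol i b)
  i∉ p with ∈-map⁻ (raise i) (subst (i ∈_) (concat-map b) p)
  ... | x , _ , i≡ = raise-miss i x (sym i≡)

f-splitCol-stuck : ∀ i b → i ∈ concat b → f i (splitCol i b) ≡ nothing
f-splitCol-stuck i b i∈ = if-false (∧-falseʳ (mem i (splitCol i b)) not-si∉)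
  where
  si∈ : suc i ∈ concat (splitCol i b)
  si∈ = subst (suc i ∈_) (sym (concat-splitCol i b)) (∈-kSplit i (concat b) i∈)
  not-si∉ : not (mem (suc i) (splitCol i b)) ≡ false
  not-si∉ rewrite memBox-complete si∈ = refl

string-stuck : ∀ i b T → fApplicable i b ≡ false → InString i b T → T ≡ b
string-stuck i b T ¬app (a , inj₁ p) = fpow-stuck i a b T (if-false ¬app) p
string-stuck i b T ¬app (a , inj₂ (_ , q , _)) with trans (sym (if-false ¬app)) q
... | ()

string-members : ∀ i b T → fApplicable i b ≡ true → InString i b T →
                 T ≡ b ⊎ T ≡ raiseCol i b ⊎ T ≡ splitCol i b
string-members i b T app (a , inj₁ p) with fpow-two i a b (raiseCol i b) T (if-true app) (f-raiseCol-stuck i b) p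
... | inj₁ T≡b = inj₁ T≡b
... | inj₂ T≡f = inj₂ (inj₁ T≡f)
string-members i b T app (a , inj₂ (b' , q , p)) with just-injective (trans (sym (if-true app)) q)
... | refl = inj₂ (inj₂ (fpow-stuck i a (splitCol i b) T
                          (f-splitCol-stuck i b (memBox-sound i (concat b) (∧-conicalˡ _ _ app))) p))

bool-cases : ∀ a → a ≡ false ⊎ a ≡ true
bool-cases false = inj₁ refl
bool-cases true = inj₂ refl

Trichotomous : (P S : Column → Set) → Column → Set
Trichotomous P S b =
  (∀ T → S T → ¬ P T) ⊎ (∀ T → S T → P T) ⊎ ((∀ T → S T → P T → T ≡ b) × P b)

trichotomy : ∀ (P S : Column → Set) b x y → (∀ T → S T → T ≡ b ⊎ T ≡ x ⊎ T ≡ y) →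
             (P x → P y) → (P y → P x) → (P x → P b) → Dec (P x) → Dec (P b) →
             Trichotomous P S b
trichotomy P S b x y members x⇒y y⇒x x⇒b (yes Px) _ = inj₂ (inj₁ all-in)
  where
  all-in : ∀ T → S T → P T
  all-in T s with members T s
  ... | inj₁ refl = x⇒b Px
  ... | inj₂ (inj₁ refl) = Px
  ... | inj₂ (inj₂ refl) = x⇒y Px
trichotomy P S b x y members x⇒y y⇒x x⇒b (no ¬Px) (yes Pb) = inj₂ (inj₂ (only-b , Pb))
  where
  only-b : ∀ T → S T → P T → T ≡ b
  only-b T s PT with members T s
  ... | inj₁ T≡b = T≡b
  ... | inj₂ (inj₁ refl) = ⊥-elim (¬Px PT)
  ... | inj₂ (inj₂ refl) = ⊥-elim (¬Px (y⇒x PT))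
trichotomy P S b x y members x⇒y y⇒x x⇒b (no ¬Px) (no ¬Pb) = inj₁ none
  where
  none : ∀ T → S T → ¬ P T
  none T s PT with members T s
  ... | inj₁ refl = ¬Pb PT
  ... | inj₂ (inj₁ refl) = ¬Px PT
  ... | inj₂ (inj₂ refl) = ¬Px (y⇒x PT)

proposition7p8 : (n k i : ℕ) (word : List ℕ) (b : Column) →
    2 ≤ n → 1 ≤ k → k ≤ n → 1 ≤ i → i < n →
    Reduced n word →
    Valid n k b → e i b ≡ nothing → eK i b ≡ nothing →
    (∀ T → InString i b T → ¬ SVTw n k word T)
    ⊎ (∀ T → InString i b T → SVTw n k word T)
    ⊎ ((∀ T → InString i b T → SVTw n k word T → T ≡ b) × SVTw n k word b)
proposition7p8 n k i word b _ _ _ _ i<n reduced valid _ _ =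
  [ string-is-b , string-has-three ]′ (bool-cases (fApplicable i b))
  where
  P : Column → Set
  P = SVTw n k word
  string-is-b : fApplicable i b ≡ false → Trichotomous P (InString i b) b
  string-is-b stuck =
    trichotomy P (InString i b) b b b (λ T s → inj₁ (string-stuck i b T stuck s))
               id id id (decide-SVTw word b valid) (decide-SVTw word b valid)
  string-has-three : fApplicable i b ≡ true → Trichotomous P (InString i b) b
  string-has-three app =
    trichotomy P (InString i b) b (raiseCol i b) (splitCol i b) (λ T s → string-members i b T app s)
               (svtw-same-maxima pos valid-f valid-fK (sym same-maxima))
               (svtw-same-maxima pos valid-fK valid-f same-maxima)
               (svtw-below pos valid valid-f (maxima-below-raiseCol i b nes))
               (decide-SVTw word (raiseCol i b) valid-f) (decide-SVTw word b valid)
    where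
    pos : All (1 ≤_) word
    pos = All.map proj₁ (proj₁ reduced)
    nes : All NonEmpty b
    nes = proj₁ (proj₂ valid)
    si∉ : suc i ∉ concat b
    si∉ = memBox-false⇒∉ (not-true (∧-conicalʳ _ _ app))
    valid-f : Valid n k (raiseCol i b)
    valid-f = Valid-raiseCol i b i<n valid si∉
    valid-fK : Valid n k (splitCol i b)
    valid-fK = Valid-splitCol i b i<n valid si∉
    same-maxima : maxima (splitCol i b) ≡ maxima (raiseCol i b)
    same-maxima = maxima-splitCol i b nes
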